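{- Let $G$ be a finite connected simple graph with blocks $B_1,\dots,B_r$. Then $P_M(B_i)$ has the integer decomposition property for each $i=1,\dots,r$ if and only if $P_M(G)$ has the integer decomposition property.
   Context: For a graph $G$ with edge set $E$, the matching polytope $P_M(G)\subset\mathbb{R}^E$ is the convex hull of the indicator vectors of all matchings of $G$. A block of $G$ is a maximal connected subgraph without a cut vertex (of itself). A lattice polytope $P\subset\mathbb{R}^d$ has the integer decomposition property if for every $t\in\mathbb{Z}_{>0}$ and $\alpha\in tP\cap\mathbb{Z}^d$ there exist $\alpha_1,\dots,\alpha_t\in P\cap\mathbb{Z}^d$ with $\alpha=\sum\alpha_i$. -}

module Defs where

open import Data.Nat using (ℕ; zero; suc; _≥_)
open import Data.Fin using (Fin; zero; suc)
open import Data.Fin.Subset using (Subset; _∈_; _∉_; _⊆_)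
open import Data.Bool using (if_then_else_)
open import Data.Vec using (lookup)
open import Data.Integer using (ℤ)
import Data.Integer as ℤ
open import Data.Rational using (ℚ; 0ℚ; 1ℚ; _≤_; _/_)
import Data.Rational as ℚ
open import Data.Product using (Σ; ∃; ∃-syntax; _×_; _,_)
open import Data.Sum using (_⊎_)
open import Relation.Binary.PropositionalEquality using (_≡_; _≢_)
open import Relation.Nullary using (¬_)

Σℚ : ∀ {k} → (Fin k → ℚ) → ℚ
Σℚ {zero}  f = 0ℚ
Σℚ {suc k} f = f zero ℚ.+ Σℚ (λ i → f (suc i))

Σℤ : ∀ {k} → (Fin k → ℤ) → ℤ
Σℤ {zero}  f = ℤ.+ 0
Σℤ {suc k} f = f zero ℤ.+ Σℤ (λ i → f (suc i))

Point : ℕ → Set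
Point d = Fin d → ℚ

toℚ : ∀ {d} → (Fin d → ℤ) → Point d
toℚ α j = α j / 1

InConv : ∀ {d} → (Point d → Set) → Point d → Set
InConv {d} S x =
  ∃[ k ] Σ (Fin k → ℚ) λ λs → Σ (Fin k → Point d) λ p →
    (∀ i → S (p i)) × (∀ i → 0ℚ ≤ λs i) × (Σℚ λs ≡ 1ℚ) ×
    (∀ j → x j ≡ Σℚ (λ i → λs i ℚ.* p i j))

InDilate : ∀ {d} → ℕ → (Point d → Set) → Point d → Set
InDilate {d} t P x = Σ (Point d) λ y → P y × (∀ j → x j ≡ (ℤ.+ t / 1) ℚ.* y j)

IDP : ∀ {d} → (Point d → Set) → Set
IDP {d} S = ∀ (t : ℕ) → t ≥ 1 → (α : Fin d → ℤ) →
  InDilate t (InConv S) (toℚ α) →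
  Σ (Fin t → Fin d → ℤ) λ αs →
    (∀ i → InConv S (toℚ (αs i))) × (∀ j → α j ≡ Σℤ (λ i → αs i j))

record Graph : Set where
  field
    n m   : ℕ
    src   : Fin m → Fin n
    tgt   : Fin m → Fin n
    loopless : ∀ e → src e ≢ tgt e
    simple   : ∀ e f →
      ((src e ≡ src f × tgt e ≡ tgt f) ⊎ (src e ≡ tgt f × tgt e ≡ src f)) →
      e ≡ f

module _ (G : Graph) where
  open Graph G

  Incident : Fin m → Fin n → Set
  Incident e x = (src e ≡ x) ⊎ (tgt e ≡ x)

  record Subgraph : Set where
    constructor sub
    field
      V : Subset n
      E : Subset m
      closed : ∀ e → e ∈ E → (src e ∈ V) × (tgt e ∈ V)

  open Subgraph

  whole : Subgraph
  whole = sub Data.Fin.Subset.⊤ Data.Fin.Subset.⊤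
            (λ e _ → Data.Fin.Subset.Properties.∈⊤ , Data.Fin.Subset.Properties.∈⊤)
    where import Data.Fin.Subset.Properties

  data Walk (P : Fin n → Set) (E : Subset m) : Fin n → Fin n → Set where
    stay : ∀ {x} → P x → Walk P E x x
    step : ∀ {x y} e → e ∈ E → P (src e) → P (tgt e) →
           ((src e ≡ x) × Walk P E (tgt e) y ⊎ (tgt e ≡ x) × Walk P E (src e) y) →
           Walk P E x y

  Connected : Subgraph → Set
  Connected H = (∃[ x ] x ∈ V H) ×
                (∀ x y → x ∈ V H → y ∈ V H → Walk (_∈ V H) (E H) x y)

  -- w is a cut vertex of H: H - w (delete w and its incident edges) has
  -- more connected components than H.  For connected H this means H - w
  -- is disconnected, i.e. two of its vertices are joined by no walk in H - w.
  -- (Edges incident with w are excluded automatically, since walks only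
  -- use edges whose endpoints lie in the allowed vertex set.)
  CutVertex : Subgraph → Fin n → Set
  CutVertex H w = w ∈ V H × ∃[ x ] ∃[ y ]
    (x ∈ V H × x ≢ w × y ∈ V H × y ≢ w ×
     ¬ Walk (λ z → z ∈ V H × z ≢ w) (E H) x y)

  _⊑_ : Subgraph → Subgraph → Set
  H ⊑ K = (V H ⊆ V K) × (E H ⊆ E K)

  NoCutVertex : Subgraph → Set
  NoCutVertex H = ∀ w → ¬ CutVertex H w

  IsBlock : Subgraph → Set
  IsBlock B = Connected B × NoCutVertex B ×
    (∀ K → B ⊑ K → Connected K → NoCutVertex K → K ⊑ B)

  IsMatching : Subset m → Subset m → Set
  IsMatching F M = M ⊆ F × (∀ e f → e ∈ M → f ∈ M → e ≢ f →
    (src e ≢ src f) × (src e ≢ tgt f) × (tgt e ≢ src f) × (tgt e ≢ tgt f))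

  χ : Subset m → Point m
  χ M j = if lookup M j then 1ℚ else 0ℚ

  -- vertex set of the matching polytope of the subgraph with edge set F
  -- (indicator vectors of matchings of that subgraph); its convex hull is
  -- P_M.  Coordinates outside F are identically 0.
  MatchingVector : Subset m → Point m → Set
  MatchingVector F x = ∃[ M ] IsMatching F M × (∀ j → x j ≡ χ M j)

-- The lattice points of P_M(F) are exactly the indicator vectors of matchings of F, so the
-- IDP for P_M(F) says that every lattice point of t·P_M(F) is a sum of t matchings of F.
-- P_M(F) is the face of P_M(G) on which the coordinates outside F vanish, so the IDP passes
-- from G to every block. Conversely, split a connected graph at a cut vertex w into two
-- connected pieces meeting only in w. Restricting a lattice point α of t·P_M to the two
-- edge sets and decomposing gives matchings X₁ … X_t and Y₁ … Y_t. The edges at w carry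
-- weight at most t in α, so at most t of these 2t matchings meet w, and after a permutation
-- π no union X_i ∪ Y_(π i) meets w twice; these unions are matchings summing to α. Splitting
-- recursively ends in connected pieces without cut vertices, each of which lies in a block.

module Submission where

open import Defs
open import Algebra.Bundles using (CommutativeMonoid)
import Algebra.Properties.CommutativeSemigroup as CommutativeSemigroupProperties
import Algebra.Properties.Semiring.Sum as SemiringSum
open import Data.Bool using (true; false; if_then_else_; _∧_; _∨_)
open import Data.Empty using (⊥-elim)
open import Data.Fin using (Fin; zero; suc; _≟_)
import Data.Fin.Properties as FinP
open import Data.Fin.Properties using (any?; all?)
open import Data.Fin.Permutation as Perm using (Permutation; _⟨$⟩ʳ_; insert; insert-punchIn)
open import Data.Fin.Subset using (Subset; _∈_; _∉_; _⊆_; _⊂_; ⁅_⁆; ∣_∣; ⊤; inside; outside; _∩_; _∪_)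
open import Data.Fin.Subset.Properties
  using (_∈?_; _⊆?_; _⊂?_; x∈p∩q⁺; x∈p∩q⁻; p∩q⊆q; x∈p∪q⁺; x∈p∪q⁻; x∈⁅x⁆; x∈⁅y⁆⇒x≡y;
         ∣p∣≤n; p⊂q⇒∣p∣<∣q∣; p⊆q⇒∣p∣≤∣q∣; anySubset?; ∈⊤)
open import Data.Integer as ℤ using (ℤ; +_)
import Data.Integer.Properties as ℤP
open import Data.Nat as ℕ using (ℕ; zero; suc; _≥_)
open import Data.Nat.Coprimality as Coprime using (1-coprimeTo)
import Data.Nat.Properties as ℕP
open import Data.Product using (Σ; Σ-syntax; ∃; ∃-syntax; _×_; _,_; proj₁; proj₂)
open import Data.Rational as ℚ using (ℚ; 0ℚ; 1ℚ; _/_; mkℚ)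
import Data.Rational.Properties as ℚP
open import Data.Sum using (_⊎_; inj₁; inj₂; [_,_]′)
open import Data.Vec using ([]; _∷_; lookup; tabulate; here; there)
open import Data.Vec.Functional using (removeAt)
open import Data.Vec.Properties using (lookup∘tabulate; lookup⇒[]=; []=⇒lookup; lookup-zipWith)
open import Function.Bundles using (_⇔_; mk⇔)
open import Relation.Binary.PropositionalEquality
open import Relation.Nullary using (¬_; yes; no; does; Dec; contradiction)
open import Relation.Nullary.Decidable
  using (dec-true; _×-dec_; _⊎-dec_; _→-dec_; ¬?; map′; decidable-stable)
open import Relation.Unary using (Decidable)

module ℕ+ = CommutativeSemigroupProperties ℕP.+-commutativeSemigroup
module ℚ+ = CommutativeSemigroupProperties (CommutativeMonoid.commutativeSemigroup ℚP.+-0-commutativeMonoid)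

fromℤ : ℤ → ℚ
fromℤ i = i / 1

fromℤ≡mkℚ : ∀ i → fromℤ i ≡ mkℚ i 0 (Coprime.sym (1-coprimeTo ℤ.∣ i ∣))
fromℤ≡mkℚ i = ℚP.↥p/↧p≡p (mkℚ i 0 _)

fromℤ-+ : ∀ a b → fromℤ (a ℤ.+ b) ≡ fromℤ a ℚ.+ fromℤ b
fromℤ-+ a b rewrite fromℤ≡mkℚ a | fromℤ≡mkℚ b =
  sym (ℚP./-cong (cong₂ ℤ._+_ (ℤP.*-identityʳ a) (ℤP.*-identityʳ b)) refl)

fromℤ-mono-≤ : ∀ {a b} → a ℤ.≤ b → fromℤ a ℚ.≤ fromℤ b
fromℤ-mono-≤ {a} {b} a≤b rewrite fromℤ≡mkℚ a | fromℤ≡mkℚ b =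
  ℚ.*≤* (subst₂ ℤ._≤_ (sym (ℤP.*-identityʳ a)) (sym (ℤP.*-identityʳ b)) a≤b)

fromℤ-cancel-≤ : ∀ {a b} → fromℤ a ℚ.≤ fromℤ b → a ℤ.≤ b
fromℤ-cancel-≤ {a} {b} a≤b rewrite fromℤ≡mkℚ a | fromℤ≡mkℚ b =
  subst₂ ℤ._≤_ (ℤP.*-identityʳ a) (ℤP.*-identityʳ b) (ℚP.drop-*≤* a≤b)

fromℤ-injective : ∀ {a b} → fromℤ a ≡ fromℤ b → a ≡ b
fromℤ-injective {a} {b} a≡b rewrite fromℤ≡mkℚ a | fromℤ≡mkℚ b = cong ℚ.numerator a≡b

0ℚ≤1ℚ : 0ℚ ℚ.≤ 1ℚ
0ℚ≤1ℚ = ℚ.*≤* (ℤ.+≤+ ℕ.z≤n)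

2ℚ≰1ℚ : ¬ (1ℚ ℚ.+ 1ℚ ℚ.≤ 1ℚ)
2ℚ≰1ℚ (ℚ.*≤* (ℤ.+≤+ (ℕ.s≤s ())))

zero-or-one : ∀ {b} → + 0 ℤ.≤ b → b ℤ.≤ + 1 → b ≡ + 0 ⊎ b ≡ + 1
zero-or-one {+ 0}             _ _                   = inj₁ refl
zero-or-one {+ 1}             _ _                   = inj₂ refl
zero-or-one {+ suc (suc _)}   _ (ℤ.+≤+ (ℕ.s≤s ()))

module ℕΣ = SemiringSum ℕP.+-*-semiring

Σℕ : ∀ {k} → (Fin k → ℕ) → ℕ
Σℕ = ℕΣ.sum

Σℕ-zero : ∀ {k} (f : Fin k → ℕ) → (∀ i → f i ≡ 0) → Σℕ f ≡ 0
Σℕ-zero {k} f f≡0 = trans (ℕΣ.sum-cong-≗ f≡0) (ℕΣ.sum-replicate-zero k)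

≤-Σℕ : ∀ {k} (f : Fin k → ℕ) j → f j ℕ.≤ Σℕ f
≤-Σℕ f zero    = ℕP.m≤m+n (f zero) _
≤-Σℕ f (suc j) = ℕP.≤-trans (≤-Σℕ (λ i → f (suc i)) j) (ℕP.m≤n+m _ (f zero))

Σℕ-≤-size : ∀ {k} (f : Fin k → ℕ) → (∀ i → f i ℕ.≤ 1) → Σℕ f ℕ.≤ k
Σℕ-≤-size {zero}  f f≤1 = ℕ.z≤n
Σℕ-≤-size {suc k} f f≤1 = ℕP.+-mono-≤ (f≤1 zero) (Σℕ-≤-size (λ i → f (suc i)) (λ i → f≤1 (suc i)))

∃-zero : ∀ {k} (f : Fin k → ℕ) → Σℕ f ℕ.< k → ∃[ j ] f j ≡ 0
∃-zero {suc k} f Σf<k with f zero in f₀≡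
... | zero  = zero , f₀≡
... | suc x with ∃-zero (λ i → f (suc i)) (ℕP.≤-trans (ℕ.s≤s (ℕP.m≤n+m _ x)) (ℕP.≤-pred Σf<k))
...   | j , fⱼ≡0 = suc j , fⱼ≡0

Σℤ-fromℕ : ∀ {k} {g : Fin k → ℤ} (f : Fin k → ℕ) → (∀ i → g i ≡ + f i) → Σℤ g ≡ + Σℕ f
Σℤ-fromℕ {zero}  f g≡f = refl
Σℤ-fromℕ {suc k} f g≡f =
  cong₂ ℤ._+_ (g≡f zero) (Σℤ-fromℕ (λ i → f (suc i)) (λ i → g≡f (suc i)))

Σℚ-fromℕ : ∀ {k} {g : Fin k → ℚ} (f : Fin k → ℕ) → (∀ i → g i ≡ fromℤ (+ f i)) →
  Σℚ g ≡ fromℤ (+ Σℕ f)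
Σℚ-fromℕ {zero}  f g≡f = refl
Σℚ-fromℕ {suc k} f g≡f =
  trans (cong₂ ℚ._+_ (g≡f zero) (Σℚ-fromℕ (λ i → f (suc i)) (λ i → g≡f (suc i))))
        (sym (fromℤ-+ (+ f zero) (+ Σℕ (λ i → f (suc i)))))

Σℚ-cong : ∀ {k} {f g : Fin k → ℚ} → (∀ i → f i ≡ g i) → Σℚ f ≡ Σℚ g
Σℚ-cong {zero}  f≡g = refl
Σℚ-cong {suc k} f≡g = cong₂ ℚ._+_ (f≡g zero) (Σℚ-cong (λ i → f≡g (suc i)))

Σℚ-zero : ∀ k → Σℚ {k} (λ _ → 0ℚ) ≡ 0ℚ
Σℚ-zero zero    = refl
Σℚ-zero (suc k) = cong (0ℚ ℚ.+_) (Σℚ-zero k)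

Σℚ-distrib-+ : ∀ {k} (f g : Fin k → ℚ) → Σℚ (λ i → f i ℚ.+ g i) ≡ Σℚ f ℚ.+ Σℚ g
Σℚ-distrib-+ {zero}  f g = refl
Σℚ-distrib-+ {suc k} f g =
  trans (cong (f zero ℚ.+ g zero ℚ.+_) (Σℚ-distrib-+ (λ i → f (suc i)) (λ i → g (suc i))))
        (ℚ+.interchange (f zero) (g zero) _ _)

*-distribˡ-Σℚ : ∀ {k} c (f : Fin k → ℚ) → c ℚ.* Σℚ f ≡ Σℚ (λ i → c ℚ.* f i)
*-distribˡ-Σℚ {zero}  c f = ℚP.*-zeroʳ c
*-distribˡ-Σℚ {suc k} c f =
  trans (ℚP.*-distribˡ-+ c (f zero) _) (cong (c ℚ.* f zero ℚ.+_) (*-distribˡ-Σℚ c (λ i → f (suc i))))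

Σℚ-comm : ∀ {k l} (f : Fin k → Fin l → ℚ) →
  Σℚ (λ i → Σℚ (λ j → f i j)) ≡ Σℚ (λ j → Σℚ (λ i → f i j))
Σℚ-comm {zero}  {l} f = sym (Σℚ-zero l)
Σℚ-comm {suc k} f =
  trans (cong (Σℚ (f zero) ℚ.+_) (Σℚ-comm (λ i → f (suc i))))
        (sym (Σℚ-distrib-+ (f zero) (λ j → Σℚ (λ i → f (suc i) j))))

Σℚ-mono-≤ : ∀ {k} {f g : Fin k → ℚ} → (∀ i → f i ℚ.≤ g i) → Σℚ f ℚ.≤ Σℚ g
Σℚ-mono-≤ {zero}  f≤g = ℚP.≤-refl
Σℚ-mono-≤ {suc k} f≤g = ℚP.+-mono-≤ (f≤g zero) (Σℚ-mono-≤ (λ i → f≤g (suc i)))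

module _ {k} (λs : Fin k → ℚ) (λs≥0 : ∀ i → 0ℚ ℚ.≤ λs i) (Σλs≡1 : Σℚ λs ≡ 1ℚ) where

  convex-combination-const : ∀ b → Σℚ (λ i → λs i ℚ.* b) ≡ b
  convex-combination-const b = begin
    Σℚ (λ i → λs i ℚ.* b) ≡⟨ Σℚ-cong (λ i → ℚP.*-comm (λs i) b) ⟩
    Σℚ (λ i → b ℚ.* λs i) ≡⟨ *-distribˡ-Σℚ b λs ⟨
    b ℚ.* Σℚ λs           ≡⟨ cong (b ℚ.*_) Σλs≡1 ⟩
    b ℚ.* 1ℚ              ≡⟨ ℚP.*-identityʳ b ⟩
    b                     ∎
    where open ≡-Reasoning

  weighted-sum-mono-≤ : ∀ {a b : Fin k → ℚ} → (∀ i → a i ℚ.≤ b i) →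
    Σℚ (λ i → λs i ℚ.* a i) ℚ.≤ Σℚ (λ i → λs i ℚ.* b i)
  weighted-sum-mono-≤ a≤b = Σℚ-mono-≤ (λ i →
    ℚP.*-monoˡ-≤-nonNeg (λs i) {{ℚ.nonNegative (λs≥0 i)}} (a≤b i))

  convex-combination-≤ : ∀ {a : Fin k → ℚ} {b} → (∀ i → a i ℚ.≤ b) → Σℚ (λ i → λs i ℚ.* a i) ℚ.≤ b
  convex-combination-≤ {b = b} a≤b = subst (_ ℚ.≤_) (convex-combination-const b) (weighted-sum-mono-≤ a≤b)

  convex-combination-≥ : ∀ {a : Fin k → ℚ} {b} → (∀ i → b ℚ.≤ a i) → b ℚ.≤ Σℚ (λ i → λs i ℚ.* a i)
  convex-combination-≥ {b = b} b≤a = subst (ℚ._≤ _) (convex-combination-const b) (weighted-sum-mono-≤ b≤a)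

setOf : ∀ {k} {P : Fin k → Set} → Decidable P → Subset k
setOf P? = tabulate (λ x → does (P? x))

module _ {k} {P : Fin k → Set} (P? : Decidable P) where

  ∈setOf⁺ : ∀ {x} → P x → x ∈ setOf P?
  ∈setOf⁺ {x} px = lookup⇒[]= x (setOf P?) (trans (lookup∘tabulate _ x) (dec-true (P? x) px))

  ∈setOf⁻ : ∀ {x} → x ∈ setOf P? → P x
  ∈setOf⁻ {x} x∈ with P? x | trans (sym (lookup∘tabulate _ x)) ([]=⇒lookup x∈)
  ... | yes px | _ = px

𝟙 : ∀ {k} → Subset k → Fin k → ℕ
𝟙 A j = if lookup A j then 1 else 0

𝟙-∈ : ∀ {k} {A : Subset k} {j} → j ∈ A → 𝟙 A j ≡ 1
𝟙-∈ j∈A rewrite []=⇒lookup j∈A = refl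

∈⇒1≤Σ𝟙 : ∀ {k} {A : Subset k} {j} → j ∈ A → 1 ℕ.≤ Σℕ (𝟙 A)
∈⇒1≤Σ𝟙 {A = A} {j} j∈A = subst (ℕ._≤ Σℕ (𝟙 A)) (𝟙-∈ j∈A) (≤-Σℕ (𝟙 A) j)

Σ𝟙-empty : ∀ {k} (A : Subset k) → (∀ {j} → j ∉ A) → Σℕ (𝟙 A) ≡ 0
Σ𝟙-empty []            _     = refl
Σ𝟙-empty (outside ∷ A) empty = Σ𝟙-empty A (λ j∈A → empty (there j∈A))
Σ𝟙-empty (inside ∷ A)  empty = contradiction here empty

Σ𝟙-subsingleton : ∀ {k} (A : Subset k) → (∀ {i j} → i ∈ A → j ∈ A → i ≡ j) → Σℕ (𝟙 A) ℕ.≤ 1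
Σ𝟙-subsingleton []            _    = ℕ.z≤n
Σ𝟙-subsingleton (outside ∷ A) uniq =
  Σ𝟙-subsingleton A (λ i∈A j∈A → FinP.suc-injective (uniq (there i∈A) (there j∈A)))
Σ𝟙-subsingleton (inside ∷ A)  uniq =
  ℕ.s≤s (ℕP.≤-reflexive (Σ𝟙-empty A (λ j∈A → FinP.0≢1+n (uniq here (there j∈A)))))

multiplicity : ∀ {t k} → (Fin t → Subset k) → Fin k → ℕ
multiplicity X j = Σℕ (λ i → 𝟙 (X i) j)

∈⇒1≤multiplicity : ∀ {t k} (X : Fin t → Subset k) {i j} → j ∈ X i → 1 ℕ.≤ multiplicity X j
∈⇒1≤multiplicity X {i} {j} j∈Xᵢ = subst (ℕ._≤ multiplicity X j) (𝟙-∈ j∈Xᵢ) (≤-Σℕ (λ i → 𝟙 (X i) j) i)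

𝟙-∩ : ∀ {k} (X A : Subset k) j → 𝟙 (X ∩ A) j ≡ (if lookup A j then 𝟙 X j else 0)
𝟙-∩ X A j rewrite lookup-zipWith _∧_ j X A with lookup X j | lookup A j
... | true  | true  = refl
... | true  | false = refl
... | false | true  = refl
... | false | false = refl

𝟙-∪ : ∀ {k} (X Y : Subset k) j → (j ∈ X → j ∉ Y) → 𝟙 (X ∪ Y) j ≡ 𝟙 X j ℕ.+ 𝟙 Y j
𝟙-∪ X Y j disjoint rewrite lookup-zipWith _∨_ j X Y with lookup X j in j∈?X | lookup Y j in j∈?Y
... | true  | true  = contradiction (lookup⇒[]= j Y j∈?Y) (disjoint (lookup⇒[]= j X j∈?X))
... | true  | false = refl
... | false | true  = refl
... | false | false = refl

multiplicity-∩ : ∀ {t k} (X : Fin t → Subset k) A j →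
  multiplicity (λ i → X i ∩ A) j ≡ (if lookup A j then multiplicity X j else 0)
multiplicity-∩ X A j with lookup A j in j∈?A
... | true  = ℕΣ.sum-cong-≗ (λ i → trans (𝟙-∩ (X i) A j) (cong (λ b → if b then 𝟙 (X i) j else 0) j∈?A))
... | false = Σℕ-zero _ (λ i → trans (𝟙-∩ (X i) A j) (cong (λ b → if b then 𝟙 (X i) j else 0) j∈?A))

⊆-from-¬∉ : ∀ {k} {A B : Subset k} → (∀ {j} → j ∈ A → ¬ j ∉ B) → A ⊆ B
⊆-from-¬∉ {B = B} ¬∉ {j} j∈A with j ∈? B
... | yes j∈B = j∈B
... | no  j∉B = contradiction j∉B (¬∉ j∈A)

if-+ : ∀ b {x y : ℕ} → (if b then x ℕ.+ y else 0) ≡ (if b then x else 0) ℕ.+ (if b then y else 0)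
if-+ true  = refl
if-+ false = refl

ones : ∀ {k} → (Fin k → ℤ) → Subset k
ones β = setOf (λ j → β j ℤ.≟ + 1)

∈ones⁻ : ∀ {k} (β : Fin k → ℤ) {j} → j ∈ ones β → β j ≡ + 1
∈ones⁻ β = ∈setOf⁻ (λ j → β j ℤ.≟ + 1)

zero-one⇒≡𝟙-ones : ∀ {k} (β : Fin k → ℤ) → (∀ j → β j ≡ + 0 ⊎ β j ≡ + 1) →
  ∀ j → β j ≡ + 𝟙 (ones β) j
zero-one⇒≡𝟙-ones β zero-or-oneᵢ j rewrite lookup∘tabulate (λ j → does (β j ℤ.≟ + 1)) j
  with β j ℤ.≟ + 1 | zero-or-oneᵢ j
... | yes β≡1 | _        = β≡1
... | no  β≢1 | inj₁ β≡0 = β≡0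
... | no  β≢1 | inj₂ β≡1 = contradiction β≡1 β≢1

⊈-witness : ∀ {k} {A B : Subset k} → ¬ A ⊆ B → ∃ λ j → j ∈ A × j ∉ B
⊈-witness {A = A} {B} A⊈B with any? (λ j → (j ∈? A) ×-dec ¬? (j ∈? B))
... | yes witness = witness
... | no  none    = ⊥-elim (A⊈B (⊆-from-¬∉ λ {j} j∈A j∉B → none (j , j∈A , j∉B)))

Linear : ∀ {d} → (Point d → ℚ) → Set
Linear {d} φ = ∀ {k} (λs : Fin k → ℚ) (p : Fin k → Point d) (x : Point d) →
  (∀ j → x j ≡ Σℚ (λ i → λs i ℚ.* p i j)) → φ x ≡ Σℚ (λ i → λs i ℚ.* φ (p i))

module _ {d : ℕ} where

  coordinate-linear : ∀ j → Linear {d} (λ x → x j)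
  coordinate-linear j λs p x x≡ = x≡ j

  +-linear : ∀ {φ ψ : Point d → ℚ} → Linear φ → Linear ψ → Linear (λ x → φ x ℚ.+ ψ x)
  +-linear {φ} {ψ} φ-linear ψ-linear λs p x x≡ = begin
    φ x ℚ.+ ψ x
      ≡⟨ cong₂ ℚ._+_ (φ-linear λs p x x≡) (ψ-linear λs p x x≡) ⟩
    Σℚ (λ i → λs i ℚ.* φ (p i)) ℚ.+ Σℚ (λ i → λs i ℚ.* ψ (p i))
      ≡⟨ Σℚ-distrib-+ (λ i → λs i ℚ.* φ (p i)) (λ i → λs i ℚ.* ψ (p i)) ⟨
    Σℚ (λ i → λs i ℚ.* φ (p i) ℚ.+ λs i ℚ.* ψ (p i))
      ≡⟨ Σℚ-cong (λ i → ℚP.*-distribˡ-+ (λs i) _ _) ⟨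
    Σℚ (λ i → λs i ℚ.* (φ (p i) ℚ.+ ψ (p i)))
      ∎
    where open ≡-Reasoning

  if-linear : ∀ b {φ : Point d → ℚ} → Linear φ → Linear (λ x → if b then φ x else 0ℚ)
  if-linear true  φ-linear λs p x x≡ = φ-linear λs p x x≡
  if-linear false φ-linear {k} λs p x x≡ =
    sym (trans (Σℚ-cong (λ i → ℚP.*-zeroʳ (λs i))) (Σℚ-zero k))

  Σ-linear : ∀ {l} {φ : Fin l → Point d → ℚ} → (∀ j → Linear (φ j)) → Linear (λ x → Σℚ (λ j → φ j x))
  Σ-linear {φ = φ} φ-linear λs p x x≡ = begin
    Σℚ (λ j → φ j x)
      ≡⟨ Σℚ-cong (λ j → φ-linear j λs p x x≡) ⟩
    Σℚ (λ j → Σℚ (λ i → λs i ℚ.* φ j (p i)))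
      ≡⟨ Σℚ-comm (λ j i → λs i ℚ.* φ j (p i)) ⟩
    Σℚ (λ i → Σℚ (λ j → λs i ℚ.* φ j (p i)))
      ≡⟨ Σℚ-cong (λ i → *-distribˡ-Σℚ (λs i) (λ j → φ j (p i))) ⟨
    Σℚ (λ i → λs i ℚ.* Σℚ (λ j → φ j (p i)))
      ∎
    where open ≡-Reasoning

  sumOver : Subset d → Point d → ℚ
  sumOver A x = Σℚ (λ j → if lookup A j then x j else 0ℚ)

  sumOver-cong : ∀ A {x y} → (∀ j → x j ≡ y j) → sumOver A x ≡ sumOver A y
  sumOver-cong A x≡y = Σℚ-cong (λ j → cong (λ z → if lookup A j then z else 0ℚ) (x≡y j))

  sumOver-toℚ : ∀ A {α : Fin d → ℤ} (f : Fin d → ℕ) → (∀ j → α j ≡ + f j) →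
    sumOver A (toℚ α) ≡ fromℤ (+ Σℕ (λ j → if lookup A j then f j else 0))
  sumOver-toℚ A {α} f α≡f = Σℚ-fromℕ (λ j → if lookup A j then f j else 0) pointwise
    where
    pointwise : ∀ j → (if lookup A j then toℚ α j else 0ℚ) ≡ fromℤ (+ (if lookup A j then f j else 0))
    pointwise j with lookup A j
    ... | true  = cong fromℤ (α≡f j)
    ... | false = refl

  sumOver-linear : ∀ A → Linear (sumOver A)
  sumOver-linear A = Σ-linear (λ j → if-linear (lookup A j) (coordinate-linear j))

  restrict : Subset d → Point d → Point d
  restrict A x j = if lookup A j then x j else 0ℚ

  dilate-linear : ∀ {φ : Point d → ℚ} → Linear φ → ∀ {t x y} →
    (∀ j → x j ≡ fromℤ (+ t) ℚ.* y j) → φ x ≡ fromℤ (+ t) ℚ.* φ y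
  dilate-linear {φ} φ-linear {t} {x} {y} x≡ =
    trans (φ-linear {1} (λ _ → fromℤ (+ t)) (λ _ → y) x
             (λ j → trans (x≡ j) (sym (ℚP.+-identityʳ (fromℤ (+ t) ℚ.* y j)))))
          (ℚP.+-identityʳ (fromℤ (+ t) ℚ.* φ y))

module _ {d : ℕ} {S : Point d → Set} where

  vertex∈InConv : ∀ {p} → S p → InConv S p
  vertex∈InConv {p} p∈S = 1 , (λ _ → 1ℚ) , (λ _ → p) , (λ _ → p∈S) , (λ _ → 0ℚ≤1ℚ) ,
    ℚP.+-identityʳ 1ℚ , λ j → sym (trans (ℚP.+-identityʳ _) (ℚP.*-identityˡ _))

  InConv-cong : ∀ {x y} → (∀ j → x j ≡ y j) → InConv S x → InConv S y
  InConv-cong x≡y (k , λs , p , p∈S , λs≥0 , Σλs≡1 , x≡) =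
    k , λs , p , p∈S , λs≥0 , Σλs≡1 , λ j → trans (sym (x≡y j)) (x≡ j)

  InDilate-cong : ∀ {t x y} → (∀ j → x j ≡ y j) → InDilate t (InConv S) x → InDilate t (InConv S) y
  InDilate-cong x≡y (z , z∈P , x≡) = z , z∈P , λ j → trans (sym (x≡y j)) (x≡ j)

  InConv-map : ∀ {T : Point d → Set} (r : Point d → Point d) → (∀ j → Linear (λ x → r x j)) →
    (∀ {p} → S p → T (r p)) → ∀ {x} → InConv S x → InConv T (r x)
  InConv-map r r-linear r-maps (k , λs , p , p∈S , λs≥0 , Σλs≡1 , x≡) =
    k , λs , (λ i → r (p i)) , (λ i → r-maps (p∈S i)) , λs≥0 , Σλs≡1 ,
    λ j → r-linear j λs p _ x≡

  InDilate-map : ∀ {T : Point d → Set} (r : Point d → Point d) → (∀ j → Linear (λ x → r x j)) →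
    (∀ {p} → S p → T (r p)) → ∀ {t x} → InDilate t (InConv S) x → InDilate t (InConv T) (r x)
  InDilate-map {T} r r-linear r-maps {t} (y , y∈P , x≡) =
    r y , InConv-map {T} r r-linear r-maps y∈P , λ j → dilate-linear (r-linear j) {t} x≡

  InDilate-mono : ∀ {T : Point d → Set} → (∀ {p} → S p → T p) → ∀ {t x} →
    InDilate t (InConv S) x → InDilate t (InConv T) x
  InDilate-mono {T} = InDilate-map {T} (λ x → x) coordinate-linear

  module _ {φ : Point d → ℚ} (φ-linear : Linear φ) {b : ℚ} where

    conv-≤ : (∀ {p} → S p → φ p ℚ.≤ b) → ∀ {x} → InConv S x → φ x ℚ.≤ b
    conv-≤ φ≤b (k , λs , p , p∈S , λs≥0 , Σλs≡1 , x≡) =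
      subst (ℚ._≤ b) (sym (φ-linear λs p _ x≡))
        (convex-combination-≤ λs λs≥0 Σλs≡1 (λ i → φ≤b (p∈S i)))

    conv-≥ : (∀ {p} → S p → b ℚ.≤ φ p) → ∀ {x} → InConv S x → b ℚ.≤ φ x
    conv-≥ b≤φ (k , λs , p , p∈S , λs≥0 , Σλs≡1 , x≡) =
      subst (b ℚ.≤_) (sym (φ-linear λs p _ x≡))
        (convex-combination-≥ λs λs≥0 Σλs≡1 (λ i → b≤φ (p∈S i)))

    dilate-≤ : (∀ {p} → S p → φ p ℚ.≤ b) → ∀ {t x} → InDilate t (InConv S) x →
      φ x ℚ.≤ fromℤ (+ t) ℚ.* b
    dilate-≤ φ≤b {t} (y , y∈P , x≡) =
      subst (ℚ._≤ fromℤ (+ t) ℚ.* b) (sym (dilate-linear φ-linear {t} x≡))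
        (ℚP.*-monoˡ-≤-nonNeg (fromℤ (+ t)) {{ℚ.nonNegative (fromℤ-mono-≤ {+ 0} {+ t} (ℤ.+≤+ ℕ.z≤n))}}
          (conv-≤ φ≤b y∈P))

module _ (G : Graph) where
  open Graph G

  Adjacent : Fin m → Fin m → Set
  Adjacent e f = ∃[ x ] Incident G e x × Incident G f x

  incident? : ∀ e x → Dec (Incident G e x)
  incident? e x = (src e ≟ x) ⊎-dec (tgt e ≟ x)

  star : Fin n → Subset m
  star w = setOf (λ e → incident? e w)

  degree : Subset m → Fin n → ℕ
  degree M w = Σℕ (𝟙 (M ∩ star w))

  module _ {F M : Subset m} where

    matching⇒nonadjacent : IsMatching G F M → ∀ {e f} → e ∈ M → f ∈ M → e ≢ f → ¬ Adjacent e f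
    matching⇒nonadjacent (_ , disjoint) e∈M f∈M e≢f (x , e∋x , f∋x)
      with disjoint _ _ e∈M f∈M e≢f | e∋x | f∋x
    ... | ss , _  , _  , _  | inj₁ p | inj₁ q = ss (trans p (sym q))
    ... | _  , st , _  , _  | inj₁ p | inj₂ q = st (trans p (sym q))
    ... | _  , _  , ts , _  | inj₂ p | inj₁ q = ts (trans p (sym q))
    ... | _  , _  , _  , tt | inj₂ p | inj₂ q = tt (trans p (sym q))

    nonadjacent⇒matching : M ⊆ F → (∀ {e f} → e ∈ M → f ∈ M → e ≢ f → ¬ Adjacent e f) →
      IsMatching G F M
    nonadjacent⇒matching M⊆F nonadjacent = M⊆F , λ e f e∈M f∈M e≢f →
      let ¬adj = nonadjacent e∈M f∈M e≢f in
      (λ eq → ¬adj (src f , inj₁ eq , inj₁ refl)) , (λ eq → ¬adj (tgt f , inj₁ eq , inj₂ refl)) ,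
      (λ eq → ¬adj (src f , inj₂ eq , inj₁ refl)) , (λ eq → ¬adj (tgt f , inj₂ eq , inj₂ refl))

    degree-≤1 : IsMatching G F M → ∀ w → degree M w ℕ.≤ 1
    degree-≤1 M-matching w = Σ𝟙-subsingleton (M ∩ star w) unique
      where
      unique : ∀ {e f} → e ∈ M ∩ star w → f ∈ M ∩ star w → e ≡ f
      unique {e} {f} e∈ f∈ with e ≟ f | x∈p∩q⁻ M (star w) e∈ | x∈p∩q⁻ M (star w) f∈
      ... | yes e≡f | _ | _ = e≡f
      ... | no e≢f | e∈M , e∋w | f∈M , f∋w = contradiction
        (w , ∈setOf⁻ (λ e → incident? e w) e∋w , ∈setOf⁻ (λ e → incident? e w) f∋w)
        (matching⇒nonadjacent M-matching e∈M f∈M e≢f)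

  1≤degree : ∀ {M e w} → e ∈ M → Incident G e w → 1 ℕ.≤ degree M w
  1≤degree {M} {e} {w} e∈M e∋w = ∈⇒1≤Σ𝟙 (x∈p∩q⁺ (e∈M , ∈setOf⁺ (λ e → incident? e w) e∋w))

  χ≡𝟙 : ∀ M j → χ G M j ≡ fromℤ (+ 𝟙 M j)
  χ≡𝟙 M j with lookup M j
  ... | true  = refl
  ... | false = refl

  sumOver-χ : ∀ A M → sumOver A (χ G M) ≡ fromℤ (+ Σℕ (𝟙 (M ∩ A)))
  sumOver-χ A M = trans (sumOver-cong A (χ≡𝟙 M)) (trans (sumOver-toℚ A (𝟙 M) (λ _ → refl))
    (cong (λ z → fromℤ (+ z)) (sym (ℕΣ.sum-cong-≗ (𝟙-∩ M A)))))

  module _ {F : Subset m} where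

    private
      MV = MatchingVector G F

    matchingVector-bounds : ∀ {p} → MV p → ∀ j → 0ℚ ℚ.≤ p j × p j ℚ.≤ 1ℚ
    matchingVector-bounds (M , _ , p≡χ) j rewrite p≡χ j with lookup M j
    ... | true  = 0ℚ≤1ℚ , ℚP.≤-refl
    ... | false = ℚP.≤-refl , 0ℚ≤1ℚ

    matchingVector-outside : ∀ {p} → MV p → ∀ {j} → j ∉ F → p j ≡ 0ℚ
    matchingVector-outside (M , (M⊆F , _) , p≡χ) {j} j∉F rewrite p≡χ j with lookup M j in j∈?M
    ... | true  = contradiction (M⊆F (lookup⇒[]= j M j∈?M)) j∉F
    ... | false = refl

    matchingVector-adjacent : ∀ {p} → MV p → ∀ {e f} → e ≢ f → Adjacent e f → p e ℚ.+ p f ℚ.≤ 1ℚ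
    matchingVector-adjacent (M , M-matching , p≡χ) {e} {f} e≢f adj
      rewrite p≡χ e | p≡χ f with lookup M e in e∈?M | lookup M f in f∈?M
    ... | true  | true  = contradiction adj
      (matching⇒nonadjacent M-matching (lookup⇒[]= e M e∈?M) (lookup⇒[]= f M f∈?M) e≢f)
    ... | true  | false = ℚP.≤-refl
    ... | false | true  = ℚP.≤-refl
    ... | false | false = 0ℚ≤1ℚ

    matchingVector-star : ∀ {p} → MV p → ∀ w → sumOver (star w) p ℚ.≤ 1ℚ
    matchingVector-star (M , M-matching , p≡χ) w =
      subst (ℚ._≤ 1ℚ) (sym (trans (sumOver-cong (star w) p≡χ) (sumOver-χ (star w) M)))
        (fromℤ-mono-≤ (ℤ.+≤+ (degree-≤1 M-matching w)))

    conv-bounds : ∀ {x} → InConv MV x → ∀ j → 0ℚ ℚ.≤ x j × x j ℚ.≤ 1ℚ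
    conv-bounds x∈P j =
      conv-≥ (coordinate-linear j) (λ p∈ → proj₁ (matchingVector-bounds p∈ j)) x∈P ,
      conv-≤ (coordinate-linear j) (λ p∈ → proj₂ (matchingVector-bounds p∈ j)) x∈P

    conv-outside : ∀ {x} → InConv MV x → ∀ {j} → j ∉ F → x j ≡ 0ℚ
    conv-outside x∈P {j} j∉F = ℚP.≤-antisym
      (conv-≤ (coordinate-linear j) (λ p∈ → ℚP.≤-reflexive (matchingVector-outside p∈ j∉F)) x∈P)
      (proj₁ (conv-bounds x∈P j))

    conv-adjacent : ∀ {x} → InConv MV x → ∀ {e f} → e ≢ f → Adjacent e f → x e ℚ.+ x f ℚ.≤ 1ℚ
    conv-adjacent x∈P {e} {f} e≢f adj =
      conv-≤ (+-linear (coordinate-linear e) (coordinate-linear f))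
        (λ {p} p∈ → matchingVector-adjacent {p} p∈ e≢f adj) x∈P

    dilate-outside : ∀ {t x} → InDilate t (InConv MV) x → ∀ {j} → j ∉ F → x j ≡ 0ℚ
    dilate-outside {t} (y , y∈P , x≡) {j} j∉F =
      trans (x≡ j) (trans (cong (fromℤ (+ t) ℚ.*_) (conv-outside y∈P j∉F)) (ℚP.*-zeroʳ (fromℤ (+ t))))

    dilate-star : ∀ {t x} → InDilate t (InConv MV) x → ∀ w → sumOver (star w) x ℚ.≤ fromℤ (+ t)
    dilate-star {t} x∈tP w = subst (_ ℚ.≤_) (ℚP.*-identityʳ (fromℤ (+ t)))
      (dilate-≤ (sumOver-linear (star w)) (λ p∈ → matchingVector-star p∈ w) {t} x∈tP)

    matching⇒latticePoint : ∀ {M} → IsMatching G F M → InConv MV (toℚ (λ j → + 𝟙 M j))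
    matching⇒latticePoint {M} M-matching =
      InConv-cong {S = MV} (χ≡𝟙 M) (vertex∈InConv {S = MV} (M , M-matching , λ j → refl))

    latticePoint⇒matching : ∀ β → InConv MV (toℚ β) →
      ∃[ M ] IsMatching G F M × (∀ j → β j ≡ + 𝟙 M j)
    latticePoint⇒matching β β∈P = M , nonadjacent⇒matching M⊆F nonadjacent , β≡𝟙
      where
      M : Subset m
      M = ones β

      β≡𝟙 : ∀ j → β j ≡ + 𝟙 M j
      β≡𝟙 = zero-one⇒≡𝟙-ones β λ j → zero-or-one (fromℤ-cancel-≤ (proj₁ (conv-bounds β∈P j)))
                                                  (fromℤ-cancel-≤ (proj₂ (conv-bounds β∈P j)))

      one : ∀ {j} → j ∈ M → fromℤ (β j) ≡ 1ℚ
      one j∈M = cong fromℤ (∈ones⁻ β j∈M)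

      M⊆F : M ⊆ F
      M⊆F = ⊆-from-¬∉ λ j∈M j∉F → contradiction (trans (sym (one j∈M)) (conv-outside β∈P j∉F)) λ ()

      nonadjacent : ∀ {e f} → e ∈ M → f ∈ M → e ≢ f → ¬ Adjacent e f
      nonadjacent e∈M f∈M e≢f adj =
        2ℚ≰1ℚ (subst (ℚ._≤ 1ℚ) (cong₂ ℚ._+_ (one e∈M) (one f∈M)) (conv-adjacent β∈P e≢f adj))


  matchingVector-mono : ∀ {F F'} → F ⊆ F' → ∀ {p} → MatchingVector G F p → MatchingVector G F' p
  matchingVector-mono F⊆F' (M , (M⊆F , disjoint) , p≡χ) = M , ((λ j∈M → F⊆F' (M⊆F j∈M)) , disjoint) , p≡χ

  Σdegree : ∀ {t} (X : Fin t → Subset m) w →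
    Σℕ (λ j → if lookup (star w) j then multiplicity X j else 0) ≡ Σℕ (λ i → degree (X i) w)
  Σdegree X w = trans (ℕΣ.sum-cong-≗ (λ j → sym (multiplicity-∩ X (star w) j)))
                      (ℕΣ.∑-comm (λ j i → 𝟙 (X i ∩ star w) j))

  matchingVector-restrict : ∀ {F} A {p} → MatchingVector G F p → MatchingVector G A (restrict A p)
  matchingVector-restrict A {p} (M , M-matching , p≡χ) =
    M ∩ A , nonadjacent⇒matching (p∩q⊆q M A) nonadjacent , pointwise
    where
    nonadjacent : ∀ {e f} → e ∈ M ∩ A → f ∈ M ∩ A → e ≢ f → ¬ Adjacent e f
    nonadjacent e∈ f∈ = matching⇒nonadjacent M-matching (proj₁ (x∈p∩q⁻ M A e∈)) (proj₁ (x∈p∩q⁻ M A f∈))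
    pointwise : ∀ j → restrict A p j ≡ χ G (M ∩ A) j
    pointwise j rewrite p≡χ j | lookup-zipWith _∧_ j M A with lookup M j | lookup A j
    ... | true  | true  = refl
    ... | true  | false = refl
    ... | false | true  = refl
    ... | false | false = refl

≤1⇒0∨1 : ∀ {x} → x ℕ.≤ 1 → x ≡ 0 ⊎ x ≡ 1
≤1⇒0∨1 ℕ.z≤n       = inj₁ refl
≤1⇒0∨1 (ℕ.s≤s ℕ.z≤n) = inj₂ refl

module _ {t} (a b : Fin (suc t) → ℕ) (a≤1 : ∀ i → a i ℕ.≤ 1) (b≤1 : ∀ i → b i ℕ.≤ 1)
         (bound : Σℕ a ℕ.+ Σℕ b ℕ.≤ suc t) where

  rest : Fin (suc t) → ℕ
  rest j = Σℕ (λ i → a (suc i)) ℕ.+ Σℕ (removeAt b j)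

  rest-bound : ∀ j → a zero ℕ.+ b j ≡ 1 → rest j ℕ.≤ t
  rest-bound j a₀+bⱼ≡1 = ℕP.≤-pred (subst (ℕ._≤ suc t) split bound)
    where
    split : Σℕ a ℕ.+ Σℕ b ≡ suc (rest j)
    split = trans (cong (Σℕ a ℕ.+_) (ℕΣ.sum-remove {i = j} b))
                  (trans (ℕ+.interchange (a zero) _ (b j) _) (cong (ℕ._+ rest j) a₀+bⱼ≡1))

  -- If a₀ = 1 then Σ b ≤ t, so some bⱼ vanishes; if a₀ = 0, take bⱼ = 1 when there is one,
  -- so that the remaining sums still fit into t.
  partner : ∃[ j ] a zero ℕ.+ b j ℕ.≤ 1 × rest j ℕ.≤ t
  partner with ≤1⇒0∨1 (a≤1 zero)
  ... | inj₂ a₀≡1 = j , ℕP.≤-reflexive a₀+bⱼ≡1 , rest-bound j a₀+bⱼ≡1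
    where
    Σb≤t : Σℕ b ℕ.≤ t
    Σb≤t = ℕP.m+n≤o⇒n≤o (Σℕ (λ i → a (suc i)))
      (ℕP.≤-pred (subst (λ x → x ℕ.+ Σℕ (λ i → a (suc i)) ℕ.+ Σℕ b ℕ.≤ suc t) a₀≡1 bound))
    j : Fin (suc t)
    j = proj₁ (∃-zero b (ℕ.s≤s Σb≤t))
    a₀+bⱼ≡1 : a zero ℕ.+ b j ≡ 1
    a₀+bⱼ≡1 = cong₂ ℕ._+_ a₀≡1 (proj₂ (∃-zero b (ℕ.s≤s Σb≤t)))
  ... | inj₁ a₀≡0 with any? (λ j → b j ℕ.≟ 1)
  ...   | yes (j , bⱼ≡1) = j , ℕP.≤-reflexive (cong₂ ℕ._+_ a₀≡0 bⱼ≡1) , rest-bound j (cong₂ ℕ._+_ a₀≡0 bⱼ≡1)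
  ...   | no  no-one = zero , subst (λ x → x ℕ.+ b zero ℕ.≤ 1) (sym a₀≡0) (b≤1 zero) , rest₀≤t
    where
    b≡0 : ∀ j → b j ≡ 0
    b≡0 j with ≤1⇒0∨1 (b≤1 j)
    ... | inj₁ bⱼ≡0 = bⱼ≡0
    ... | inj₂ bⱼ≡1 = ⊥-elim (no-one (j , bⱼ≡1))
    rest₀≤t : rest zero ℕ.≤ t
    rest₀≤t = subst (λ x → Σℕ (λ i → a (suc i)) ℕ.+ x ℕ.≤ t) (sym (Σℕ-zero _ (λ i → b≡0 (suc i))))
      (subst (ℕ._≤ t) (sym (ℕP.+-identityʳ _)) (Σℕ-≤-size _ (λ i → a≤1 (suc i))))

pairing : ∀ t (a b : Fin t → ℕ) → (∀ i → a i ℕ.≤ 1) → (∀ i → b i ℕ.≤ 1) → Σℕ a ℕ.+ Σℕ b ℕ.≤ t →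
  Σ[ π ∈ Permutation t t ] ∀ i → a i ℕ.+ b (π ⟨$⟩ʳ i) ℕ.≤ 1
pairing zero    a b a≤1 b≤1 bound = Perm.id , λ ()
pairing (suc t) a b a≤1 b≤1 bound with partner a b a≤1 b≤1 bound
... | j , a₀+bⱼ≤1 , rest≤t
  with pairing t (λ i → a (suc i)) (removeAt b j) (λ i → a≤1 (suc i)) (λ i → b≤1 _) rest≤t
...   | π , paired = insert zero j π , λ
  { zero    → a₀+bⱼ≤1
  ; (suc i) → subst (λ k → a (suc i) ℕ.+ b k ℕ.≤ 1) (sym (insert-punchIn zero j π i)) (paired i) }

restrictℤ : ∀ {k} → Subset k → (Fin k → ℤ) → Fin k → ℤ
restrictℤ A α j = if lookup A j then α j else + 0

restrict-toℚ : ∀ {k} A (α : Fin k → ℤ) j → restrict A (toℚ α) j ≡ toℚ (restrictℤ A α) j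
restrict-toℚ A α j with lookup A j
... | true  = refl
... | false = refl

restrictℤ-split : ∀ {k} {A B : Subset k} {α : Fin k → ℤ} → (∀ {j} → j ∈ A → j ∉ B) →
  (∀ {j} → j ∉ A → j ∉ B → α j ≡ + 0) → ∀ j → α j ≡ restrictℤ A α j ℤ.+ restrictℤ B α j
restrictℤ-split {A = A} {B} {α} A∩B≡∅ outside≡0 j with lookup A j in j∈?A | lookup B j in j∈?B
... | true  | true  = contradiction (lookup⇒[]= j B j∈?B) (A∩B≡∅ (lookup⇒[]= j A j∈?A))
... | true  | false = sym (ℤP.+-identityʳ (α j))
... | false | true  = sym (ℤP.+-identityˡ (α j))
... | false | false = outside≡0 (λ j∈A → true≢false (trans (sym ([]=⇒lookup j∈A)) j∈?A))
                                (λ j∈B → true≢false (trans (sym ([]=⇒lookup j∈B)) j∈?B))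
  where
  true≢false : true ≢ false
  true≢false ()

module _ (G : Graph) where
  open Graph G

  MatchingDecomposition : Subset m → ℕ → (Fin m → ℤ) → Set
  MatchingDecomposition F t α = Σ[ M ∈ (Fin t → Subset m) ]
    (∀ i → IsMatching G F (M i)) × (∀ j → α j ≡ + multiplicity M j)

  Decomposable : Subset m → Set
  Decomposable F = ∀ t → t ≥ 1 → ∀ α → InDilate t (InConv (MatchingVector G F)) (toℚ α) →
    MatchingDecomposition F t α

  module _ {F : Subset m} where

    IDP⇒decomposable : IDP (MatchingVector G F) → Decomposable F
    IDP⇒decomposable idp t t≥1 α α∈tP = M , (λ i → proj₁ (proj₂ (matchings i))) , α≡multiplicity
      where
      αs : Fin t → Fin m → ℤ
      αs = proj₁ (idp t t≥1 α α∈tP)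

      αsᵢ∈P : ∀ i → InConv (MatchingVector G F) (toℚ (αs i))
      αsᵢ∈P = proj₁ (proj₂ (idp t t≥1 α α∈tP))

      α≡Σαs : ∀ j → α j ≡ Σℤ (λ i → αs i j)
      α≡Σαs = proj₂ (proj₂ (idp t t≥1 α α∈tP))

      matchings : ∀ i → ∃[ M ] IsMatching G F M × (∀ j → αs i j ≡ + 𝟙 M j)
      matchings i = latticePoint⇒matching G (αs i) (αsᵢ∈P i)

      M : Fin t → Subset m
      M i = proj₁ (matchings i)

      α≡multiplicity : ∀ j → α j ≡ + multiplicity M j
      α≡multiplicity j = trans (α≡Σαs j) (Σℤ-fromℕ (λ i → 𝟙 (M i) j) (λ i → proj₂ (proj₂ (matchings i)) j))

    decomposable⇒IDP : Decomposable F → IDP (MatchingVector G F)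
    decomposable⇒IDP decomposable t t≥1 α α∈tP =
      (λ i j → + 𝟙 (M i) j) , (λ i → matching⇒latticePoint G (M-matching i)) ,
      λ j → trans (α≡multiplicity j) (sym (Σℤ-fromℕ (λ i → 𝟙 (M i) j) (λ i → refl)))
      where
      M : Fin t → Subset m
      M = proj₁ (decomposable t t≥1 α α∈tP)

      M-matching : ∀ i → IsMatching G F (M i)
      M-matching = proj₁ (proj₂ (decomposable t t≥1 α α∈tP))

      α≡multiplicity : ∀ j → α j ≡ + multiplicity M j
      α≡multiplicity = proj₂ (proj₂ (decomposable t t≥1 α α∈tP))

  IDP-⊆ : ∀ {F F'} → F ⊆ F' → IDP (MatchingVector G F') → IDP (MatchingVector G F)
  IDP-⊆ {F} {F'} F⊆F' idp = decomposable⇒IDP decomposable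
    where
    decomposable : Decomposable F
    decomposable t t≥1 α α∈tP = M , (λ i → M⊆F i , proj₂ (M-matching i)) , α≡multiplicity
      where
      decomposition : MatchingDecomposition F' t α
      decomposition = IDP⇒decomposable {F = F'} idp t t≥1 α
        (InDilate-mono (λ {p} → matchingVector-mono G F⊆F' {p}) {t} α∈tP)

      M : Fin t → Subset m
      M = proj₁ decomposition

      M-matching : ∀ i → IsMatching G F' (M i)
      M-matching = proj₁ (proj₂ decomposition)

      α≡multiplicity : ∀ j → α j ≡ + multiplicity M j
      α≡multiplicity = proj₂ (proj₂ decomposition)

      M⊆F : ∀ i → M i ⊆ F
      M⊆F i = ⊆-from-¬∉ λ {j} j∈Mᵢ j∉F → ℕP.m<n⇒n≢0 (∈⇒1≤multiplicity M j∈Mᵢ) (ℤP.+-injective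
        (trans (sym (α≡multiplicity j)) (fromℤ-injective {b = + 0} (dilate-outside G {F = F} {t = t} α∈tP j∉F))))

  module Gluing {F F₁ F₂ : Subset m} {w : Fin n}
    (F₁⊆F : F₁ ⊆ F) (F₂⊆F : F₂ ⊆ F)
    (F⊆F₁∪F₂ : ∀ {j} → j ∈ F → j ∈ F₁ ⊎ j ∈ F₂)
    (F₁∩F₂≡∅ : ∀ {j} → j ∈ F₁ → j ∉ F₂)
    (meet-only-at-w : ∀ {e f x} → e ∈ F₁ → f ∈ F₂ → Incident G e x → Incident G f x → x ≡ w)
    where

    ∪-matching : ∀ {X Y} → IsMatching G F₁ X → IsMatching G F₂ Y →
      degree G X w ℕ.+ degree G Y w ℕ.≤ 1 → IsMatching G F (X ∪ Y)
    ∪-matching {X} {Y} X-matching Y-matching degrees≤1 = nonadjacent⇒matching G X∪Y⊆F nonadjacent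
      where
      X∪Y⊆F : X ∪ Y ⊆ F
      X∪Y⊆F j∈ with x∈p∪q⁻ X Y j∈
      ... | inj₁ j∈X = F₁⊆F (proj₁ X-matching j∈X)
      ... | inj₂ j∈Y = F₂⊆F (proj₁ Y-matching j∈Y)

      across : ∀ {e f} → e ∈ X → f ∈ Y → ¬ Adjacent G e f
      across e∈X f∈Y (x , e∋x , f∋x)
        with meet-only-at-w (proj₁ X-matching e∈X) (proj₁ Y-matching f∈Y) e∋x f∋x
      ... | refl = contradiction
        (ℕP.≤-trans (ℕP.+-mono-≤ (1≤degree G e∈X e∋x) (1≤degree G f∈Y f∋x)) degrees≤1) λ { (ℕ.s≤s ()) }

      nonadjacent : ∀ {e f} → e ∈ X ∪ Y → f ∈ X ∪ Y → e ≢ f → ¬ Adjacent G e f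
      nonadjacent e∈ f∈ e≢f with x∈p∪q⁻ X Y e∈ | x∈p∪q⁻ X Y f∈
      ... | inj₁ e∈X | inj₁ f∈X = matching⇒nonadjacent G X-matching e∈X f∈X e≢f
      ... | inj₂ e∈Y | inj₂ f∈Y = matching⇒nonadjacent G Y-matching e∈Y f∈Y e≢f
      ... | inj₁ e∈X | inj₂ f∈Y = across e∈X f∈Y
      ... | inj₂ e∈Y | inj₁ f∈X = λ (x , e∋x , f∋x) → across f∈X e∈Y (x , f∋x , e∋x)

    module _ (decomposable₁ : Decomposable F₁) (decomposable₂ : Decomposable F₂)
             (t : ℕ) (t≥1 : t ≥ 1) (α : Fin m → ℤ)
             (α∈tP : InDilate t (InConv (MatchingVector G F)) (toℚ α)) where

      restricted : ∀ A → InDilate t (InConv (MatchingVector G A)) (toℚ (restrictℤ A α))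
      restricted A = InDilate-cong {S = MatchingVector G A} {t = t} (restrict-toℚ A α)
        (InDilate-map {T = MatchingVector G A} (restrict A) (λ j → if-linear (lookup A j) (coordinate-linear j))
          (λ {p} → matchingVector-restrict G A {p}) {t} α∈tP)

      α-split : ∀ j → α j ≡ restrictℤ F₁ α j ℤ.+ restrictℤ F₂ α j
      α-split = restrictℤ-split F₁∩F₂≡∅ λ j∉F₁ j∉F₂ →
        fromℤ-injective {b = + 0} (dilate-outside G {F = F} {t = t} α∈tP (λ j∈F →
          [ j∉F₁ , j∉F₂ ]′ (F⊆F₁∪F₂ j∈F)))

      decomposition₁ : MatchingDecomposition F₁ t (restrictℤ F₁ α)
      decomposition₁ = decomposable₁ t t≥1 (restrictℤ F₁ α) (restricted F₁)

      decomposition₂ : MatchingDecomposition F₂ t (restrictℤ F₂ α)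
      decomposition₂ = decomposable₂ t t≥1 (restrictℤ F₂ α) (restricted F₂)

      X Y : Fin t → Subset m
      X = proj₁ decomposition₁
      Y = proj₁ decomposition₂

      X-matching : ∀ i → IsMatching G F₁ (X i)
      X-matching = proj₁ (proj₂ decomposition₁)

      Y-matching : ∀ i → IsMatching G F₂ (Y i)
      Y-matching = proj₁ (proj₂ decomposition₂)

      α≡ : ∀ j → α j ≡ + (multiplicity X j ℕ.+ multiplicity Y j)
      α≡ j = trans (α-split j) (cong₂ ℤ._+_ (proj₂ (proj₂ decomposition₁) j) (proj₂ (proj₂ decomposition₂) j))

      degree-bound : Σℕ (λ i → degree G (X i) w) ℕ.+ Σℕ (λ i → degree G (Y i) w) ℕ.≤ t
      degree-bound = ℤP.drop‿+≤+ (fromℤ-cancel-≤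
        (subst (ℚ._≤ fromℤ (+ t)) star-sum (dilate-star G {F = F} {t = t} α∈tP w)))
        where
        S = star G w
        star-sum : sumOver S (toℚ α) ≡
          fromℤ (+ (Σℕ (λ i → degree G (X i) w) ℕ.+ Σℕ (λ i → degree G (Y i) w)))
        star-sum = trans (sumOver-toℚ S _ α≡) (cong (λ z → fromℤ (+ z)) (begin
          Σℕ (λ j → if lookup S j then multiplicity X j ℕ.+ multiplicity Y j else 0)
            ≡⟨ ℕΣ.sum-cong-≗ (λ j → if-+ (lookup S j)) ⟩
          Σℕ (λ j → (if lookup S j then multiplicity X j else 0) ℕ.+ (if lookup S j then multiplicity Y j else 0))
            ≡⟨ ℕΣ.∑-distrib-+ (λ j → if lookup S j then multiplicity X j else 0) _ ⟩
          Σℕ (λ j → if lookup S j then multiplicity X j else 0) ℕ.+ Σℕ (λ j → if lookup S j then multiplicity Y j else 0)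
            ≡⟨ cong₂ ℕ._+_ (Σdegree G X w) (Σdegree G Y w) ⟩
          Σℕ (λ i → degree G (X i) w) ℕ.+ Σℕ (λ i → degree G (Y i) w) ∎))
          where open ≡-Reasoning

      pairs : Σ[ π ∈ Permutation t t ] ∀ i → degree G (X i) w ℕ.+ degree G (Y (π ⟨$⟩ʳ i)) w ℕ.≤ 1
      pairs = pairing t (λ i → degree G (X i) w) (λ i → degree G (Y i) w)
        (λ i → degree-≤1 G (X-matching i) w) (λ i → degree-≤1 G (Y-matching i) w) degree-bound

      π : Permutation t t
      π = proj₁ pairs

      Z : Fin t → Subset m
      Z i = X i ∪ Y (π ⟨$⟩ʳ i)

      multiplicity-Z : ∀ j → multiplicity Z j ≡ multiplicity X j ℕ.+ multiplicity Y j
      multiplicity-Z j = begin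
        Σℕ (λ i → 𝟙 (X i ∪ Y (π ⟨$⟩ʳ i)) j)
          ≡⟨ ℕΣ.sum-cong-≗ (λ i → 𝟙-∪ (X i) _ j (sides-disjoint i)) ⟩
        Σℕ (λ i → 𝟙 (X i) j ℕ.+ 𝟙 (Y (π ⟨$⟩ʳ i)) j)
          ≡⟨ ℕΣ.∑-distrib-+ (λ i → 𝟙 (X i) j) (λ i → 𝟙 (Y (π ⟨$⟩ʳ i)) j) ⟩
        multiplicity X j ℕ.+ Σℕ (λ i → 𝟙 (Y (π ⟨$⟩ʳ i)) j)
          ≡⟨ cong (multiplicity X j ℕ.+_) (ℕΣ.∑-permute (λ k → 𝟙 (Y k) j) π) ⟨
        multiplicity X j ℕ.+ multiplicity Y j
          ∎
        where
        open ≡-Reasoning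
        sides-disjoint : ∀ i → j ∈ X i → j ∉ Y (π ⟨$⟩ʳ i)
        sides-disjoint i j∈X j∈Y = F₁∩F₂≡∅ (proj₁ (X-matching i) j∈X) (proj₁ (Y-matching (π ⟨$⟩ʳ i)) j∈Y)

      glued : MatchingDecomposition F t α
      glued = Z , (λ i → ∪-matching (X-matching i) (Y-matching (π ⟨$⟩ʳ i)) (proj₂ pairs i)) ,
              λ j → trans (α≡ j) (cong +_ (sym (multiplicity-Z j)))

    glue : Decomposable F₁ → Decomposable F₂ → Decomposable F
    glue = glued

module Walks (G : Graph) where
  open Graph G

  Joins : Fin m → Fin n → Fin n → Set
  Joins e a b = (src e ≡ a × tgt e ≡ b) ⊎ (tgt e ≡ a × src e ≡ b)

  joins-sym : ∀ {e a b} → Joins e a b → Joins e b a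
  joins-sym (inj₁ (s≡a , t≡b)) = inj₂ (t≡b , s≡a)
  joins-sym (inj₂ (t≡a , s≡b)) = inj₁ (s≡b , t≡a)

  module _ {P : Fin n → Set} {E : Subset m} where

    walk-start : ∀ {x y} → Walk G P E x y → P x
    walk-start (stay px)                          = px
    walk-start (step _ _ ps _ (inj₁ (refl , _))) = ps
    walk-start (step _ _ _ pt (inj₂ (refl , _))) = pt

    walk-end : ∀ {x y} → Walk G P E x y → P y
    walk-end (stay py)                     = py
    walk-end (step _ _ _ _ (inj₁ (_ , w))) = walk-end w
    walk-end (step _ _ _ _ (inj₂ (_ , w))) = walk-end w

    _◅◅_ : ∀ {x u z} → Walk G P E x u → Walk G P E u z → Walk G P E x z
    stay _                          ◅◅ w′ = w′
    step e e∈E ps pt (inj₁ (q , w)) ◅◅ w′ = step e e∈E ps pt (inj₁ (q , w ◅◅ w′))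
    step e e∈E ps pt (inj₂ (q , w)) ◅◅ w′ = step e e∈E ps pt (inj₂ (q , w ◅◅ w′))

    _▻_ : ∀ {x a b e} → Walk G P E x a → e ∈ E × Joins e a b × P b → Walk G P E x b
    w ▻ (e∈E , inj₁ (refl , refl) , pb) = w ◅◅ step _ e∈E (walk-end w) pb (inj₁ (refl , stay pb))
    w ▻ (e∈E , inj₂ (refl , refl) , pb) = w ◅◅ step _ e∈E pb (walk-end w) (inj₂ (refl , stay pb))

    reverse : ∀ {x y} → Walk G P E x y → Walk G P E y x
    reverse (stay px)                            = stay px
    reverse (step e e∈E ps pt (inj₁ (refl , w))) = reverse w ▻ (e∈E , inj₂ (refl , refl) , ps)
    reverse (step e e∈E ps pt (inj₂ (refl , w))) = reverse w ▻ (e∈E , inj₁ (refl , refl) , pt)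

  module Reachability {P : Fin n → Set} (P? : Decidable P) (E : Subset m) (x : Fin n) where

    Reached : Subset n → Set
    Reached R = ∀ {z} → z ∈ R → Walk G P E x z

    Link : Subset n → Fin n → Fin m → Set
    Link R z e = e ∈ E × P (src e) × P (tgt e) × ((src e ∈ R × tgt e ≡ z) ⊎ (tgt e ∈ R × src e ≡ z))

    Grows : Subset n → Fin n → Set
    Grows R z = z ∈ R ⊎ ∃ (Link R z)

    grows? : ∀ R → Decidable (Grows R)
    grows? R z = (z ∈? R) ⊎-dec any? (λ e →
      (e ∈? E) ×-dec P? (src e) ×-dec P? (tgt e) ×-dec
      ((src e ∈? R) ×-dec (tgt e ≟ z) ⊎-dec (tgt e ∈? R) ×-dec (src e ≟ z)))

    grow : Subset n → Subset n
    grow R = setOf (grows? R)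

    ⊆-grow : ∀ R → R ⊆ grow R
    ⊆-grow R z∈R = ∈setOf⁺ (grows? R) (inj₁ z∈R)

    grow-reached : ∀ {R} → Reached R → Reached (grow R)
    grow-reached {R} reached z∈ with ∈setOf⁻ (grows? R) z∈
    ... | inj₁ z∈R = reached z∈R
    ... | inj₂ (e , e∈E , ps , pt , inj₁ (s∈R , refl)) = reached s∈R ▻ (e∈E , inj₁ (refl , refl) , pt)
    ... | inj₂ (e , e∈E , ps , pt , inj₂ (t∈R , refl)) = reached t∈R ▻ (e∈E , inj₂ (refl , refl) , ps)

    closed-under-walks : ∀ {R} → grow R ⊆ R → ∀ {a b} → a ∈ R → Walk G P E a b → b ∈ R
    closed-under-walks {R} closed a∈R (stay _) = a∈R
    closed-under-walks {R} closed a∈R (step e e∈E ps pt (inj₁ (refl , w))) =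
      closed-under-walks closed (closed (∈setOf⁺ (grows? R) (inj₂ (e , e∈E , ps , pt , inj₁ (a∈R , refl))))) w
    closed-under-walks {R} closed a∈R (step e e∈E ps pt (inj₂ (refl , w))) =
      closed-under-walks closed (closed (∈setOf⁺ (grows? R) (inj₂ (e , e∈E , ps , pt , inj₂ (a∈R , refl))))) w

    saturate : ∀ fuel R → Reached R → x ∈ R → n ℕ.< fuel ℕ.+ ∣ R ∣ →
      ∃[ R′ ] Reached R′ × x ∈ R′ × grow R′ ⊆ R′
    saturate zero    R _ _ bound = ⊥-elim (ℕP.<-irrefl refl (ℕP.<-≤-trans bound (∣p∣≤n R)))
    saturate (suc f) R reached x∈R bound with R ⊂? grow R
    ... | yes R⊂grow = saturate f (grow R) (grow-reached reached) (⊆-grow R x∈R)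
      (ℕP.<-≤-trans bound (subst (ℕ._≤ f ℕ.+ ∣ grow R ∣) (ℕP.+-suc f ∣ R ∣)
        (ℕP.+-monoʳ-≤ f (p⊂q⇒∣p∣<∣q∣ R⊂grow))))
    ... | no  R⊄grow = R , reached , x∈R , ⊆-from-¬∉ λ z∈ z∉R → R⊄grow (⊆-grow R , _ , z∈ , z∉R)

    decide : P x → ∀ y → Dec (Walk G P E x y)
    decide px y with saturate (suc n) ⁅ x ⁆ start (x∈⁅x⁆ x) (ℕP.m≤m+n (suc n) _)
      where
      start : Reached ⁅ x ⁆
      start z∈ = subst (Walk G P E x) (sym (x∈⁅y⁆⇒x≡y x z∈)) (stay px)
    ... | R , reached , x∈R , closed with y ∈? R
    ...   | yes y∈R = yes (reached y∈R)
    ...   | no  y∉R = no λ w → y∉R (closed-under-walks closed x∈R w)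

  reachable? : ∀ {P : Fin n → Set} → Decidable P → ∀ E x y → Dec (Walk G P E x y)
  reachable? P? E x y with P? x
  ... | no  ¬px = no λ w → ¬px (walk-start w)
  ... | yes px  = Reachability.decide P? E x px y

module _ (G : Graph) where
  open Graph G
  open Subgraph
  open Walks G

  endpoints-∈ : ∀ (H : Subgraph G) {e a b} → e ∈ E H → Joins e a b → a ∈ V H × b ∈ V H
  endpoints-∈ H e∈E (inj₁ (refl , refl)) = closed H _ e∈E
  endpoints-∈ H e∈E (inj₂ (refl , refl)) = proj₂ (closed H _ e∈E) , proj₁ (closed H _ e∈E)

  InducedEdge : Subgraph G → Subset n → Fin m → Set
  InducedEdge H U e = e ∈ E H × src e ∈ U × tgt e ∈ U

  inducedEdge? : ∀ H U e → Dec (InducedEdge H U e)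
  inducedEdge? H U e = (e ∈? E H) ×-dec (src e ∈? U) ×-dec (tgt e ∈? U)

  induced : Subgraph G → Subset n → Subgraph G
  induced H U = sub U (setOf (inducedEdge? H U)) λ e e∈ → proj₂ (∈setOf⁻ (inducedEdge? H U) e∈)

  induced-edge⁻ : ∀ {H U e} → e ∈ E (induced H U) → InducedEdge H U e
  induced-edge⁻ {H} {U} = ∈setOf⁻ (inducedEdge? H U)

  incident-∈ : ∀ {H U e x} → e ∈ E (induced H U) → Incident G e x → x ∈ U
  incident-∈ {H} {U} e∈ (inj₁ refl) = proj₁ (proj₂ (induced-edge⁻ {H} {U} e∈))
  incident-∈ {H} {U} e∈ (inj₂ refl) = proj₂ (proj₂ (induced-edge⁻ {H} {U} e∈))

  ClosedAwayFrom : Subgraph G → Fin n → Subset n → Set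
  ClosedAwayFrom H w U = ∀ {e a b} → e ∈ E H → Joins e a b → a ∈ U → a ≢ w → b ∈ U

  module _ {H : Subgraph G} {w : Fin n} {U : Subset n} (closed : ClosedAwayFrom H w U) (w∈U : w ∈ U) where

    walk-to-induced : ∀ {z} → z ∈ U → Walk G (_∈ V H) (E H) z w → Walk G (_∈ U) (E (induced H U)) z w
    walk-to-induced {z} z∈U walk with z ≟ w
    ... | yes refl = stay z∈U
    walk-to-induced z∈U (stay _) | no z≢w = stay z∈U
    walk-to-induced z∈U (step e e∈E _ _ (inj₁ (refl , walk))) | no z≢w =
      step e (∈setOf⁺ (inducedEdge? H U) (e∈E , z∈U , t∈U)) z∈U t∈U (inj₁ (refl , walk-to-induced t∈U walk))
      where t∈U = closed e∈E (inj₁ (refl , refl)) z∈U z≢w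
    walk-to-induced z∈U (step e e∈E _ _ (inj₂ (refl , walk))) | no z≢w =
      step e (∈setOf⁺ (inducedEdge? H U) (e∈E , s∈U , z∈U)) s∈U z∈U (inj₂ (refl , walk-to-induced s∈U walk))
      where s∈U = closed e∈E (inj₂ (refl , refl)) z∈U z≢w

    induced-connected : Connected G H → w ∈ V H → U ⊆ V H → Connected G (induced H U)
    induced-connected (_ , walks) w∈H U⊆H = (w , w∈U) , λ a b a∈U b∈U → to-w a∈U ◅◅ reverse (to-w b∈U)
      where
      to-w : ∀ {z} → z ∈ U → Walk G (_∈ U) (E (induced H U)) z w
      to-w z∈U = walk-to-induced z∈U (walks _ w (U⊆H z∈U) w∈H)

  module SplitAt {H : Subgraph G} {w : Fin n} (cut : CutVertex G H w) where

    private
      w∈H = proj₁ cut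
      x = proj₁ (proj₂ cut)
      y = proj₁ (proj₂ (proj₂ cut))
      x∈H = proj₁ (proj₂ (proj₂ (proj₂ cut)))
      x≢w = proj₁ (proj₂ (proj₂ (proj₂ (proj₂ cut))))
      y∈H = proj₁ (proj₂ (proj₂ (proj₂ (proj₂ (proj₂ cut)))))
      y≢w = proj₁ (proj₂ (proj₂ (proj₂ (proj₂ (proj₂ (proj₂ cut))))))
      x↛y = proj₂ (proj₂ (proj₂ (proj₂ (proj₂ (proj₂ (proj₂ cut))))))

    AvoidsW : Fin n → Set
    AvoidsW z = z ∈ V H × z ≢ w

    C : Subset n
    C = setOf (reachable? (λ z → (z ∈? V H) ×-dec ¬? (z ≟ w)) (E H) x)

    C⁻ : ∀ {z} → z ∈ C → Walk G AvoidsW (E H) x z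
    C⁻ = ∈setOf⁻ (reachable? (λ z → (z ∈? V H) ×-dec ¬? (z ≟ w)) (E H) x)

    C⁺ : ∀ {z} → Walk G AvoidsW (E H) x z → z ∈ C
    C⁺ = ∈setOf⁺ (reachable? (λ z → (z ∈? V H) ×-dec ¬? (z ≟ w)) (E H) x)

    C-step : ∀ {e a b} → e ∈ E H → Joins e a b → a ∈ C → b ≢ w → b ∈ C
    C-step e∈E joins a∈C b≢w = C⁺ (C⁻ a∈C ▻ (e∈E , joins , proj₂ (endpoints-∈ H e∈E joins) , b≢w))

    w∉C : w ∉ C
    w∉C w∈C = proj₂ (walk-end (C⁻ w∈C)) refl

    V₁ V₂ : Subset n
    V₁ = C ∪ ⁅ w ⁆
    V₂ = setOf (λ z → (z ∈? V H) ×-dec ¬? (z ∈? C))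

    V₁⁻ : ∀ {z} → z ∈ V₁ → z ∈ C ⊎ z ≡ w
    V₁⁻ z∈V₁ with x∈p∪q⁻ C ⁅ w ⁆ z∈V₁
    ... | inj₁ z∈C = inj₁ z∈C
    ... | inj₂ z∈w = inj₂ (x∈⁅y⁆⇒x≡y w z∈w)

    w∈V₁ : w ∈ V₁
    w∈V₁ = x∈p∪q⁺ (inj₂ (x∈⁅x⁆ w))

    V₂⁻ : ∀ {z} → z ∈ V₂ → z ∈ V H × z ∉ C
    V₂⁻ = ∈setOf⁻ (λ z → (z ∈? V H) ×-dec ¬? (z ∈? C))

    V₂⁺ : ∀ {z} → z ∈ V H → z ∉ C → z ∈ V₂
    V₂⁺ z∈H z∉C = ∈setOf⁺ (λ z → (z ∈? V H) ×-dec ¬? (z ∈? C)) (z∈H , z∉C)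

    V₁∩V₂⊆w : ∀ {z} → z ∈ V₁ → z ∈ V₂ → z ≡ w
    V₁∩V₂⊆w z∈V₁ z∈V₂ with V₁⁻ z∈V₁
    ... | inj₁ z∈C = contradiction z∈C (proj₂ (V₂⁻ z∈V₂))
    ... | inj₂ z≡w = z≡w

    V₁-closed : ClosedAwayFrom H w V₁
    V₁-closed {b = b} e∈E joins a∈V₁ a≢w with V₁⁻ a∈V₁ | b ≟ w
    ... | inj₂ a≡w | _        = contradiction a≡w a≢w
    ... | inj₁ a∈C | yes refl = w∈V₁
    ... | inj₁ a∈C | no  b≢w  = x∈p∪q⁺ (inj₁ (C-step e∈E joins a∈C b≢w))

    V₂-closed : ClosedAwayFrom H w V₂
    V₂-closed e∈E joins a∈V₂ a≢w = V₂⁺ (proj₂ (endpoints-∈ H e∈E joins))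
      λ b∈C → proj₂ (V₂⁻ a∈V₂) (C-step e∈E (joins-sym joins) b∈C a≢w)

    V₁⊂V : V₁ ⊂ V H
    V₁⊂V = V₁⊆V , y , y∈H , λ y∈V₁ → [ (λ y∈C → x↛y (C⁻ y∈C)) , y≢w ]′ (V₁⁻ y∈V₁)
      where
      V₁⊆V : V₁ ⊆ V H
      V₁⊆V z∈V₁ with V₁⁻ z∈V₁
      ... | inj₁ z∈C  = proj₁ (walk-end (C⁻ z∈C))
      ... | inj₂ refl = w∈H

    V₂⊂V : V₂ ⊂ V H
    V₂⊂V = (λ z∈V₂ → proj₁ (V₂⁻ z∈V₂)) , x , x∈H , λ x∈V₂ → proj₂ (V₂⁻ x∈V₂) (C⁺ (stay (x∈H , x≢w)))

    w∈V₂ : w ∈ V₂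
    w∈V₂ = V₂⁺ w∈H w∉C

    H₁ H₂ : Subgraph G
    H₁ = induced H V₁
    H₂ = induced H V₂

    H₁-connected : Connected G H → Connected G H₁
    H₁-connected conn = induced-connected {H} {w} {V₁} V₁-closed w∈V₁ conn w∈H (proj₁ V₁⊂V)

    H₂-connected : Connected G H → Connected G H₂
    H₂-connected conn = induced-connected {H} {w} {V₂} V₂-closed w∈V₂ conn w∈H (proj₁ V₂⊂V)

    E₁⊆E : E H₁ ⊆ E H
    E₁⊆E e∈ = proj₁ (induced-edge⁻ {H} {V₁} e∈)

    E₂⊆E : E H₂ ⊆ E H
    E₂⊆E e∈ = proj₁ (induced-edge⁻ {H} {V₂} e∈)

    outside-V₁ : ∀ {e a b} → e ∈ E H → Joins e a b → a ∉ V₁ → a ∈ V₂ × b ∈ V₂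
    outside-V₁ e∈E joins a∉V₁ = a∈V₂ , V₂-closed e∈E joins a∈V₂ a≢w
      where
      a≢w = λ a≡w → a∉V₁ (subst (_∈ V₁) (sym a≡w) w∈V₁)
      a∈V₂ = V₂⁺ (proj₁ (endpoints-∈ H e∈E joins)) (λ a∈C → a∉V₁ (x∈p∪q⁺ (inj₁ a∈C)))

    E⊆E₁∪E₂ : ∀ {e} → e ∈ E H → e ∈ E H₁ ⊎ e ∈ E H₂
    E⊆E₁∪E₂ {e} e∈E with src e ∈? V₁ | tgt e ∈? V₁
    ... | yes s∈V₁ | yes t∈V₁ = inj₁ (∈setOf⁺ (inducedEdge? H V₁) (e∈E , s∈V₁ , t∈V₁))
    ... | no  s∉V₁ | _        = inj₂ (∈setOf⁺ (inducedEdge? H V₂) (e∈E , outside-V₁ e∈E (inj₁ (refl , refl)) s∉V₁))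
    ... | yes _    | no  t∉V₁ with outside-V₁ e∈E (inj₂ (refl , refl)) t∉V₁
    ...   | t∈V₂ , s∈V₂ = inj₂ (∈setOf⁺ (inducedEdge? H V₂) (e∈E , s∈V₂ , t∈V₂))

    E₁∩E₂≡∅ : ∀ {e} → e ∈ E H₁ → e ∉ E H₂
    E₁∩E₂≡∅ {e} e∈E₁ e∈E₂ = loopless e (trans (V₁∩V₂⊆w s₁ s₂) (sym (V₁∩V₂⊆w t₁ t₂)))
      where
      s₁ = proj₁ (proj₂ (induced-edge⁻ {H} {V₁} e∈E₁))
      t₁ = proj₂ (proj₂ (induced-edge⁻ {H} {V₁} e∈E₁))
      s₂ = proj₁ (proj₂ (induced-edge⁻ {H} {V₂} e∈E₂))
      t₂ = proj₂ (proj₂ (induced-edge⁻ {H} {V₂} e∈E₂))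

    meet-only-at-w : ∀ {e f z} → e ∈ E H₁ → f ∈ E H₂ → Incident G e z → Incident G f z → z ≡ w
    meet-only-at-w e∈E₁ f∈E₂ e∋z f∋z =
      V₁∩V₂⊆w (incident-∈ {H} {V₁} e∈E₁ e∋z) (incident-∈ {H} {V₂} f∈E₂ f∋z)

module _ (G : Graph) where
  open Graph G
  open Subgraph
  open Walks G

  cutVertex? : ∀ H w → Dec (CutVertex G H w)
  cutVertex? H w = (w ∈? V H) ×-dec any? λ x → any? λ y →
    (x ∈? V H) ×-dec ¬? (x ≟ w) ×-dec (y ∈? V H) ×-dec ¬? (y ≟ w) ×-dec
    ¬? (reachable? (λ z → (z ∈? V H) ×-dec ¬? (z ≟ w)) (E H) x y)

  connected? : ∀ H → Dec (Connected G H)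
  connected? H = any? (_∈? V H) ×-dec all? λ x → all? λ y →
    (x ∈? V H) →-dec (y ∈? V H) →-dec reachable? (_∈? V H) (E H) x y

  _⊑?_ : ∀ H K → Dec (_⊑_ G H K)
  H ⊑? K = (V H ⊆? V K) ×-dec (E H ⊆? E K)

  ⊑-refl : ∀ {H} → _⊑_ G H H
  ⊑-refl = (λ z∈ → z∈) , (λ e∈ → e∈)

  ⊑-trans : ∀ {H K L} → _⊑_ G H K → _⊑_ G K L → _⊑_ G H L
  ⊑-trans (V⊆ , E⊆) (V⊆′ , E⊆′) = (λ z∈ → V⊆′ (V⊆ z∈)) , (λ e∈ → E⊆′ (E⊆ e∈))

  size : Subgraph G → ℕ
  size H = ∣ V H ∣ ℕ.+ ∣ E H ∣

  size≤n+m : ∀ H → size H ℕ.≤ n ℕ.+ m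
  size≤n+m H = ℕP.+-mono-≤ (∣p∣≤n (V H)) (∣p∣≤n (E H))

  ⊏⇒size< : ∀ {H K} → _⊑_ G H K → ¬ _⊑_ G K H → size H ℕ.< size K
  ⊏⇒size< {H} {K} (V⊆ , E⊆) K⋢H with V K ⊆? V H
  ... | yes V⊇ = ℕP.+-mono-≤-< (p⊆q⇒∣p∣≤∣q∣ V⊆) (p⊂q⇒∣p∣<∣q∣ (E⊆ , ⊈-witness λ E⊇ → K⋢H (V⊇ , E⊇)))
  ... | no  V⊉ = ℕP.+-mono-<-≤ (p⊂q⇒∣p∣<∣q∣ (V⊆ , ⊈-witness V⊉)) (p⊆q⇒∣p∣≤∣q∣ E⊆)

  ProperExtension : Subgraph G → Subgraph G → Set
  ProperExtension B K = _⊑_ G B K × Connected G K × NoCutVertex G K × ¬ _⊑_ G K B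

  Closed : Subset n → Subset m → Set
  Closed U F = ∀ e → e ∈ F → src e ∈ U × tgt e ∈ U

  properExtension? : ∀ B → Dec (∃ (ProperExtension B))
  properExtension? B =
    map′ (λ (U , F , closed , ext) → sub U F closed , ext) (λ (K , ext) → V K , E K , closed K , ext)
      (anySubset? λ U → anySubset? λ F → candidate? U F)
    where
    candidate? : ∀ U F → Dec (Σ (Closed U F) λ closed → ProperExtension B (sub U F closed))
    candidate? U F with all? (λ e → (e ∈? F) →-dec (src e ∈? U) ×-dec (tgt e ∈? U))
    ... | no  ¬closed = no λ (closed , _) → ¬closed closed
    ... | yes closed  = map′ (closed ,_) (λ (_ , ext) → ext)
      ((B ⊑? K) ×-dec connected? K ×-dec all? (λ w → ¬? (cutVertex? K w)) ×-dec ¬? (K ⊑? B))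
      where K = sub U F closed

  extend-to-block : ∀ fuel K → Connected G K → NoCutVertex G K → n ℕ.+ m ℕ.< fuel ℕ.+ size K →
    ∃[ B ] _⊑_ G K B × IsBlock G B
  extend-to-block zero K _ _ bound = ⊥-elim (ℕP.<-irrefl refl (ℕP.<-≤-trans bound (size≤n+m K)))
  extend-to-block (suc f) K connected no-cut bound with properExtension? K
  ... | no  maximal = K , ⊑-refl {K} , connected , no-cut , λ K′ K⊑K′ connected′ no-cut′ →
    decidable-stable (K′ ⊑? K) λ K′⋢K → maximal (K′ , K⊑K′ , connected′ , no-cut′ , K′⋢K)
  ... | yes (K′ , K⊑K′ , connected′ , no-cut′ , K′⋢K) =
    let (B , K′⊑B , B-block) = extend-to-block f K′ connected′ no-cut′ bound′
    in B , ⊑-trans {K} {K′} {B} K⊑K′ K′⊑B , B-block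
    where
    bound′ : n ℕ.+ m ℕ.< f ℕ.+ size K′
    bound′ = ℕP.<-≤-trans bound (subst (ℕ._≤ f ℕ.+ size K′) (ℕP.+-suc f (size K))
      (ℕP.+-monoʳ-≤ f (⊏⇒size< {K} {K′} K⊑K′ K′⋢K)))

  block-containing : ∀ K → Connected G K → NoCutVertex G K → ∃[ B ] _⊑_ G K B × IsBlock G B
  block-containing K connected no-cut =
    extend-to-block (suc (n ℕ.+ m)) K connected no-cut (ℕ.s≤s (ℕP.m≤m+n (n ℕ.+ m) (size K)))

  IDP-at-cut : ∀ {H w} (cut : CutVertex G H w) → let open SplitAt G {H} {w} cut in
    IDP (MatchingVector G (E H₁)) → IDP (MatchingVector G (E H₂)) → IDP (MatchingVector G (E H))
  IDP-at-cut {H} {w} cut idp₁ idp₂ = decomposable⇒IDP G {F = E H}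
    (Gluing.glue G E₁⊆E E₂⊆E E⊆E₁∪E₂ E₁∩E₂≡∅ meet-only-at-w
      (IDP⇒decomposable G {F = E H₁} idp₁) (IDP⇒decomposable G {F = E H₂} idp₂))
    where open SplitAt G {H} {w} cut

  connected⇒IDP : (∀ K → Connected G K → NoCutVertex G K → IDP (MatchingVector G (E K))) →
    ∀ H → Connected G H → IDP (MatchingVector G (E H))
  connected⇒IDP 2-connected⇒IDP H = by-size (suc ∣ V H ∣) H ℕP.≤-refl
    where
    by-size : ∀ s H → ∣ V H ∣ ℕ.< s → Connected G H → IDP (MatchingVector G (E H))
    by-size (suc s) H (ℕ.s≤s size≤s) connected with any? (cutVertex? H)
    ... | no  no-cut    = 2-connected⇒IDP H connected λ w cut → no-cut (w , cut)
    ... | yes (w , cut) = IDP-at-cut {H} {w} cut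
      (by-size s H₁ (ℕP.<-≤-trans (p⊂q⇒∣p∣<∣q∣ V₁⊂V) size≤s) (H₁-connected connected))
      (by-size s H₂ (ℕP.<-≤-trans (p⊂q⇒∣p∣<∣q∣ V₂⊂V) size≤s) (H₂-connected connected))
      where open SplitAt G {H} {w} cut

proposition3p7 : (G : Graph) → Connected G (whole G) →
    ((∀ B → IsBlock G B → IDP (MatchingVector G (Subgraph.E B))) ⇔
     IDP (MatchingVector G ⊤))
proposition3p7 G G-connected = mk⇔
  (λ blocks-IDP → connected⇒IDP G (λ K connected no-cut →
      let (B , K⊑B , B-block) = block-containing G K connected no-cut
      in IDP-⊆ G (proj₂ K⊑B) (blocks-IDP B B-block))
    (whole G) G-connected)
  (λ IDP-G B _ → IDP-⊆ G (λ _ → ∈⊤) IDP-G)
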